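{- For every $n\ge 4$, $F_n = F(A_{n+1},f_n)$.
   Context: Words are finite sequences over $\{0,1\}$; for sets of words $UV=\{uv:u\in U,v\in V\}$. Define $A_1=\{0\}$, $A_2=\{1\}$ and for $n\ge3$, $A_n=A_{n-1}A_{n-2}\cup A_{n-2}A_{n-1}$. All words of $A_n$ have common length $f_n$ (Fibonacci numbers, $f_1=f_2=1$, $f_n=f_{n-1}+f_{n-2}$). A word $x$ is a factor of $w$ if $w=uxv$ for some (possibly empty) words $u,v$. For a set of words $S$ and $m\ge1$, $F(S,m)$ is the set of all factors of length $m$ of words in $S$. $F_n$ denotes the set of all factors of length $f_n$ of words in $\bigcup_{m\ge1}A_m$. -}

module Defs where

open import Data.Nat using (ℕ; zero; suc; _+_; _≥_)
open import Data.Bool using (Bool; false; true)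
open import Data.List using (List; []; _∷_; _++_; length)
open import Data.Product using (Σ; ∃; _×_; _,_)
open import Relation.Binary.PropositionalEquality using (_≡_)

-- Words over the alphabet {0,1}; 0 is encoded as false, 1 as true.
Word : Set
Word = List Bool

WordSet : Set₁
WordSet = Word → Set

_·_ : WordSet → WordSet → WordSet
(U · V) w = Σ Word λ u → Σ Word λ v → U u × V v × w ≡ u ++ v

_∪_ : WordSet → WordSet → WordSet
(U ∪ V) w = Data.Sum._⊎_ (U w) (V w)
  where import Data.Sum

f : ℕ → ℕ
f zero = zero
f (suc zero) = suc zero
f (suc (suc n)) = f (suc n) + f n

-- A n for n ≥ 1: A 1 = {0}, A 2 = {1}, A n = A(n-1)A(n-2) ∪ A(n-2)A(n-1).
-- A 0 is not used by the paper; we set it to the empty set.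
A : ℕ → WordSet
A zero w = Data.Empty.⊥
  where import Data.Empty
A (suc zero) w = w ≡ false ∷ []
A (suc (suc zero)) w = w ≡ true ∷ []
A (suc (suc (suc n))) = (A (suc (suc n)) · A (suc n)) ∪ (A (suc n) · A (suc (suc n)))

IsFactor : Word → Word → Set
IsFactor x w = Σ Word λ u → Σ Word λ v → w ≡ u ++ (x ++ v)

F : WordSet → ℕ → WordSet
F S m x = length x ≡ m × Σ Word λ w → S w × IsFactor x w

Fn : ℕ → WordSet
Fn n x = length x ≡ f n × Σ ℕ λ m → m ≥ 1 × Σ Word λ w → A m w × IsFactor x w

-- Prefixes of length < f k of words in A m (m ≥ k) are already prefixes of
-- words in A k, and symmetrically for suffixes, since A is closed under
-- reversal.  A factor x of length f n of a word of some A m with m ≥ n + 2 lies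
-- in one of the two halves of A m = A (m-1) A (m-2) ∪ A (m-2) A (m-1), where
-- induction applies, or it crosses the border as x = s t.  Then s is a suffix
-- and t a prefix of words of A n, and as |s| + |t| = f (n-1) + f (n-2), either
-- |t| < f (n-1) or |s| ≤ f (n-2) < f (n-1) (this needs n ≥ 4).  Descending once
-- more, s t is a factor of a word of A n A (n-1) or of A (n-1) A n, both of
-- which lie in A (n+1).
module Submission where

open import Defs
open import Data.Nat using (ℕ; suc; _≥_)
open import Function.Bundles using (_⇔_)

open import Data.Nat
  using (zero; _+_; _≤_; _<_; _≤′_; ≤′-refl; ≤′-step; z≤n; s≤s; _≤?_; _<?_)
open import Data.Nat.Properties
open import Data.List using (List; []; _∷_; _++_; length; reverse)
open import Data.List.Properties
  using (∷-injective; length-++; length-++-≤ˡ; length-++-≤ʳ; ++-assoc; ++-identityʳ;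
         reverse-++; length-reverse; reverse-involutive)
open import Data.Product using (Σ; _×_; _,_)
open import Data.Sum using (_⊎_; inj₁; inj₂)
open import Data.Empty using (⊥; ⊥-elim)
open import Relation.Nullary using (yes; no)
open import Relation.Binary.PropositionalEquality
open import Function.Bundles using (mk⇔)

IsPrefix : Word → Word → Set
IsPrefix p w = Σ Word λ r → w ≡ p ++ r

IsSuffix : Word → Word → Set
IsSuffix s w = Σ Word λ r → w ≡ r ++ s

Prefixes : WordSet → WordSet
Prefixes S p = Σ Word λ w → S w × IsPrefix p w

Suffixes : WordSet → WordSet
Suffixes S s = Σ Word λ w → S w × IsSuffix s w

++-split : ∀ {a} {X : Set a} (u v p r : List X) → u ++ v ≡ p ++ r →
           (Σ (List X) λ m → u ≡ p ++ m × r ≡ m ++ v) ⊎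
           (Σ (List X) λ t → p ≡ u ++ t × v ≡ t ++ r)
++-split []      v p       r eq = inj₂ (p , refl , eq)
++-split (c ∷ u) v []      r eq = inj₁ (c ∷ u , refl , sym eq)
++-split (c ∷ u) v (d ∷ p) r eq with ∷-injective eq
... | refl , eq′ with ++-split u v p r eq′
...   | inj₁ (m , u≡p++m , r≡m++v) = inj₁ (m , cong (c ∷_) u≡p++m , r≡m++v)
...   | inj₂ (t , p≡u++t , v≡t++r) = inj₂ (t , cong (c ∷_) p≡u++t , v≡t++r)

prefix-++ : ∀ {p u} z → IsPrefix p u → IsPrefix p (u ++ z)
prefix-++ {p} z (m , refl) = m ++ z , ++-assoc p m z

++-prefix : ∀ u {t v} → IsPrefix t v → IsPrefix (u ++ t) (u ++ v)
++-prefix u {t} (r , refl) = r , sym (++-assoc u t r)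

factor-++ : ∀ {x w} z → IsFactor x w → IsFactor x (w ++ z)
factor-++ {x} z (a , b , refl) =
  a , b ++ z , trans (++-assoc a (x ++ b) z) (cong (a ++_) (++-assoc x b z))

suffix++prefix-factor : ∀ {s t y z} → IsSuffix s y → IsPrefix t z → IsFactor (s ++ t) (y ++ z)
suffix++prefix-factor {s} {t} (r , refl) (r′ , refl) =
  r , r′ , trans (++-assoc r s (t ++ r′)) (cong (r ++_) (sym (++-assoc s t r′)))

length-factor : ∀ {x w} → IsFactor x w → length x ≤ length w
length-factor {x} (a , b , refl) = ≤-trans (length-++-≤ˡ x) (length-++-≤ʳ (x ++ b) {a})

reverse-prefix : ∀ {p w} → IsPrefix p w → IsSuffix (reverse p) (reverse w)
reverse-prefix {p} (r , refl) = reverse r , reverse-++ p r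

reverse-suffix : ∀ {s w} → IsSuffix s w → IsPrefix (reverse s) (reverse w)
reverse-suffix {s} (r , refl) = reverse r , reverse-++ r s

data FactorOf++ (x u v : Word) : Set where
  inˡ    : IsFactor x u → FactorOf++ x u v
  inʳ    : IsFactor x v → FactorOf++ x u v
  across : ∀ {s t} → x ≡ s ++ t → IsSuffix s u → IsPrefix t v →
           0 < length s → 0 < length t → FactorOf++ x u v

factor-of-++ : ∀ {x} u v → IsFactor x (u ++ v) → FactorOf++ x u v
factor-of-++ {x} u v (a , b , uv≡axb) with ++-split u v a (x ++ b) uv≡axb
... | inj₂ (t , _ , v≡txb) = inʳ (t , b , v≡txb)
... | inj₁ (m , u≡am , xb≡mv) with ++-split m v x b (sym xb≡mv)
...   | inj₁ (m′ , m≡xm′ , _) = inˡ (a , m′ , trans u≡am (cong (a ++_) m≡xm′))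
...   | inj₂ (t , x≡mt , v≡tb) = crossing m t u≡am x≡mt v≡tb
  where
  crossing : ∀ m t → u ≡ a ++ m → x ≡ m ++ t → v ≡ t ++ b → FactorOf++ x u v
  crossing [] t _ x≡t v≡tb = inʳ ([] , b , trans v≡tb (cong (_++ b) (sym x≡t)))
  crossing m [] u≡am x≡m _ =
    inˡ (a , [] , trans u≡am (cong (a ++_) (trans (sym (++-identityʳ m))
                                            (trans (sym x≡m) (sym (++-identityʳ x))))))
  crossing (_ ∷ _) (_ ∷ _) u≡am x≡mt v≡tb = across x≡mt (a , u≡am) (b , v≡tb) (s≤s z≤n) (s≤s z≤n)

0<f[1+n] : ∀ n → 0 < f (suc n)
0<f[1+n] zero    = s≤s z≤n
0<f[1+n] (suc n) = ≤-trans (0<f[1+n] n) (m≤m+n _ _)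

f[n]≤f[1+n] : ∀ n → f n ≤ f (suc n)
f[n]≤f[1+n] zero    = z≤n
f[n]≤f[1+n] (suc n) = m≤m+n (f (suc n)) (f n)

f-mono-≤ : ∀ {m n} → m ≤ n → f m ≤ f n
f-mono-≤ m≤n = go (≤⇒≤′ m≤n)
  where
  go : ∀ {m n} → m ≤′ n → f m ≤ f n
  go ≤′-refl          = ≤-refl
  go (≤′-step {n} m≤n) = ≤-trans (go m≤n) (f[n]≤f[1+n] n)

length-A : ∀ m {w} → A m w → length w ≡ f m
length-A (suc zero)          refl = refl
length-A (suc (suc zero))    refl = refl
length-A (suc (suc (suc m))) (inj₁ (u , v , Au , Av , refl)) =
  trans (length-++ u) (cong₂ _+_ (length-A (2 + m) Au) (length-A (suc m) Av))
length-A (suc (suc (suc m))) (inj₂ (u , v , Au , Av , refl)) =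
  trans (length-++ u) (trans (cong₂ _+_ (length-A (suc m) Au) (length-A (2 + m) Av))
                              (+-comm (f (suc m)) _))

A-nonempty : ∀ m → Σ Word (A (suc m))
A-nonempty zero          = _ , refl
A-nonempty (suc zero)    = _ , refl
A-nonempty (suc (suc m)) with A-nonempty (suc m) | A-nonempty m
... | u , Au | v , Av = u ++ v , inj₁ (u , v , Au , Av , refl)

A-reverse : ∀ m {w} → A m w → A m (reverse w)
A-reverse (suc zero)          refl = refl
A-reverse (suc (suc zero))    refl = refl
A-reverse (suc (suc (suc m))) (inj₁ (u , v , Au , Av , refl)) =
  inj₂ (reverse v , reverse u , A-reverse (suc m) Av , A-reverse (2 + m) Au , reverse-++ u v)
A-reverse (suc (suc (suc m))) (inj₂ (u , v , Au , Av , refl)) =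
  inj₁ (reverse v , reverse u , A-reverse (2 + m) Av , A-reverse (suc m) Au , reverse-++ u v)

[]∈Prefixes-A : ∀ m → Prefixes (A (suc m)) []
[]∈Prefixes-A m with A-nonempty m
... | w , Aw = w , Aw , w , refl

PrefixStep : ℕ → Set
PrefixStep m = ∀ {p} → Prefixes (A (suc m)) p → length p < f m → Prefixes (A m) p

prefixes-A-step-from-smaller : ∀ i → PrefixStep (suc (suc i)) → PrefixStep (suc i) → PrefixStep (3 + i)
prefixes-A-step-from-smaller i _ _ {p} (_ , inj₁ (u , v , Au , _ , pr≡uv) , r , refl) p<f
  with ++-split u v p r (sym pr≡uv)
... | inj₁ (m , u≡pm , _) = u , Au , m , u≡pm
... | inj₂ (t , refl , _) = ⊥-elim (<⇒≱ p<f (begin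
  f (3 + i)        ≡⟨ sym (length-A (3 + i) Au) ⟩
  length u         ≤⟨ length-++-≤ˡ u ⟩
  length (u ++ t)  ∎))
  where open ≤-Reasoning
prefixes-A-step-from-smaller i step₂ step₁ (_ , inj₂ (u , v , Au , Av , pr≡uv) , r , refl) p<f
  with ++-split u v _ r (sym pr≡uv)
... | inj₁ (m , u≡pm , _) =
  let z , Az = A-nonempty i
  in  u ++ z , inj₁ (u , z , Au , Az , refl) , prefix-++ z (m , u≡pm)
-- p = u t with |t| < f (1+i), so t descends from A (3+i) to A (1+i) and u t ⊑ u A (1+i).
... | inj₂ (t , refl , v≡tr) =
  let t<f = +-cancelˡ-< (f (2 + i)) (length t) (f (suc i))
              (subst (_< f (3 + i))
                     (trans (length-++ u) (cong (_+ length t) (length-A (2 + i) Au))) p<f)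
      v′ , Av′ , t⊑v′ = step₁ (step₂ (v , Av , r , v≡tr) (<-≤-trans t<f (f[n]≤f[1+n] (suc i)))) t<f
  in  u ++ v′ , inj₁ (u , v′ , Au , Av′ , refl) , ++-prefix u t⊑v′

prefixes-A-step : ∀ m → PrefixStep m
prefixes-A-step zero _ ()
prefixes-A-step (suc m)  {[]}    _ _ = []∈Prefixes-A m
prefixes-A-step 1        {_ ∷ _} _ (s≤s ())
prefixes-A-step 2        {_ ∷ _} _ (s≤s ())
prefixes-A-step (suc (suc (suc i))) =
  prefixes-A-step-from-smaller i (prefixes-A-step (suc (suc i))) (prefixes-A-step (suc i))

prefixes-A-descend : ∀ {k m p} → k ≤ m → Prefixes (A m) p → length p < f k → Prefixes (A k) p
prefixes-A-descend {k} {p = p} k≤m P p<f = go (≤⇒≤′ k≤m) P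
  where
  go : ∀ {m} → k ≤′ m → Prefixes (A m) p → Prefixes (A k) p
  go ≤′-refl            P = P
  go (≤′-step {m} k≤m) P = go k≤m (prefixes-A-step m P (<-≤-trans p<f (f-mono-≤ (≤′⇒≤ k≤m))))

suffixes-A-descend : ∀ {k m s} → k ≤ m → Suffixes (A m) s → length s < f k → Suffixes (A k) s
suffixes-A-descend {k} {m} {s} k≤m (w , Aw , s⊒w) s<f =
  let w′ , Aw′ , s′⊑w′ = prefixes-A-descend k≤m (reverse w , A-reverse m Aw , reverse-suffix s⊒w)
                                               (subst (_< f k) (sym (length-reverse s)) s<f)
  in  reverse w′ , A-reverse k Aw′ ,
      subst (λ q → IsSuffix q (reverse w′)) (reverse-involutive s) (reverse-prefix s′⊑w′)

module _ (j : ℕ) where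

  private
    N : ℕ
    N = 4 + j

  crossing-factor : ∀ {s t} → Suffixes (A N) s → Prefixes (A N) t → length (s ++ t) ≡ f N →
                    F (A (suc N)) (f N) (s ++ t)
  crossing-factor {s} {t} (y , Ay , s⊒y) (y′ , Ay′ , t⊑y′) |st| with length t <? f (3 + j)
  ... | yes t<f =
    let z , Az , t⊑z = prefixes-A-step (3 + j) (y′ , Ay′ , t⊑y′) t<f
    in  |st| , y ++ z , inj₁ (y , z , Ay , Az , refl) , suffix++prefix-factor s⊒y t⊑z
  ... | no t≮f =
    let z , Az , s⊒z = suffixes-A-descend (n≤1+n (3 + j)) (y , Ay , s⊒y) s<f
    in  |st| , z ++ y′ , inj₂ (z , y′ , Az , Ay′ , refl) , suffix++prefix-factor s⊒z t⊑y′
    where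
    open ≤-Reasoning
    s≤f : length s ≤ f (2 + j)
    s≤f = +-cancelʳ-≤ (f (3 + j)) (length s) (f (2 + j)) (begin
      length s + f (3 + j)    ≤⟨ +-monoʳ-≤ (length s) (≮⇒≥ t≮f) ⟩
      length s + length t     ≡⟨ sym (length-++ s) ⟩
      length (s ++ t)         ≡⟨ |st| ⟩
      f (3 + j) + f (2 + j)   ≡⟨ +-comm (f (3 + j)) _ ⟩
      f (2 + j) + f (3 + j)   ∎)
    s<f : length s < f (3 + j)
    s<f = ≤-<-trans s≤f (m<m+n (f (2 + j)) (0<f[1+n] j))

  G : WordSet
  G = F (A (suc N)) (f N)

  no-long-factor : ∀ {m w x} → m < N → A m w → IsFactor x w → length x ≡ f N → ⊥
  no-long-factor {m} {w} {x} (s≤s m≤3+j) Aw x⊑w |x| = <-irrefl |x| (begin-strict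
    length x   ≤⟨ length-factor x⊑w ⟩
    length w   ≡⟨ length-A m Aw ⟩
    f m        ≤⟨ f-mono-≤ m≤3+j ⟩
    f (3 + j)  <⟨ m<m+n (f (3 + j)) (0<f[1+n] (suc j)) ⟩
    f N        ∎)
    where open ≤-Reasoning

  factor-of-A-≤1+N : ∀ {m w x} → m ≤ suc N → A m w → IsFactor x w → length x ≡ f N → G x
  factor-of-A-≤1+N m≤1+N Aw x⊑w |x| with m≤n⇒m<n∨m≡n m≤1+N
  ... | inj₂ refl = |x| , _ , Aw , x⊑w
  ... | inj₁ (s≤s m≤N) with m≤n⇒m<n∨m≡n m≤N
  ...   | inj₁ m<N = ⊥-elim (no-long-factor m<N Aw x⊑w |x|)
  ...   | inj₂ refl =
    let z , Az = A-nonempty (2 + j)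
    in  |x| , _ , inj₁ (_ , z , Aw , Az , refl) , factor-++ z x⊑w

  factor-of-concat : ∀ {p q u v x} → N ≤ p → N ≤ q → A p u → A q v →
                      (IsFactor x u → G x) → (IsFactor x v → G x) →
                      IsFactor x (u ++ v) → length x ≡ f N → G x
  factor-of-concat N≤p N≤q Au Av in-u in-v x⊑uv |x| with factor-of-++ _ _ x⊑uv
  ... | inˡ x⊑u = in-u x⊑u
  ... | inʳ x⊑v = in-v x⊑v
  ... | across {s} {t} refl s⊒u t⊑v 0<s 0<t =
    crossing-factor (suffixes-A-descend N≤p (_ , Au , s⊒u) s<f)
                    (prefixes-A-descend N≤q (_ , Av , t⊑v) t<f) |x|
    where
    s<f : length s < f N
    s<f = subst (length s <_) (trans (sym (length-++ s)) |x|) (m<m+n (length s) 0<t)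
    t<f : length t < f N
    t<f = subst (length t <_) (trans (sym (length-++ s)) |x|) (m<n+m (length t) 0<s)

  factor-of-A : ∀ m {w x} → A m w → IsFactor x w → length x ≡ f N → G x
  factor-of-A 1 = factor-of-A-≤1+N (s≤s z≤n)
  factor-of-A 2 = factor-of-A-≤1+N (s≤s (s≤s z≤n))
  factor-of-A (suc (suc (suc k))) Aw x⊑w |x| with N ≤? suc k
  ... | no N≰1+k = factor-of-A-≤1+N (s≤s (≰⇒> N≰1+k)) Aw x⊑w |x|
  factor-of-A (suc (suc (suc k))) (inj₁ (u , v , Au , Av , refl)) x⊑w |x| | yes N≤1+k =
    factor-of-concat (m≤n⇒m≤1+n N≤1+k) N≤1+k Au Av
      (λ x⊑u → factor-of-A (2 + k) Au x⊑u |x|) (λ x⊑v → factor-of-A (suc k) Av x⊑v |x|) x⊑w |x|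
  factor-of-A (suc (suc (suc k))) (inj₂ (u , v , Au , Av , refl)) x⊑w |x| | yes N≤1+k =
    factor-of-concat N≤1+k (m≤n⇒m≤1+n N≤1+k) Au Av
      (λ x⊑u → factor-of-A (suc k) Au x⊑u |x|) (λ x⊑v → factor-of-A (2 + k) Av x⊑v |x|) x⊑w |x|

proposition8 : (n : ℕ) → n ≥ 4 → (x : Word) → Fn n x ⇔ F (A (suc n)) (f n) x
proposition8 (suc (suc (suc (suc j)))) (s≤s (s≤s (s≤s (s≤s z≤n)))) x = mk⇔
  (λ (|x| , m , _ , w , Aw , x⊑w) → factor-of-A j m Aw x⊑w |x|)
  (λ (|x| , w , Aw , x⊑w) → |x| , 5 + j , s≤s z≤n , w , Aw , x⊑w)
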